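{- If $f\in\#\mathsf{FA}$, then for every constant $c\in\mathbb{N}$ the function $w\mapsto\binom{f(w)}{c}$ is in $\#\mathsf{FA}$.
   Context: $\mathbb{N}=\{0,1,2,\dots\}$. An NFA is a tuple $M=(Q,\Sigma,\mathrm{wt},\mathrm{in},\mathrm{out})$ with $Q,\Sigma$ finite, $\mathrm{wt}:Q\times\Sigma\times Q\to\mathbb{N}$, $\mathrm{in},\mathrm{out}:Q\to\mathbb{N}$; on input $w=w_1\cdots w_n$ it outputs $\sum_{q_0,\dots,q_n\in Q}\mathrm{in}(q_0)\prod_{i=1}^n\mathrm{wt}(q_{i-1},w_i,q_i)\mathrm{out}(q_n)$. $\#\mathsf{FA}$ is the set of functions $\Sigma^\star\to\mathbb{N}$ (over finite alphabets $\Sigma$) computed by NFAs. -}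

module Defs where

open import Data.Nat using (ℕ; zero; suc; _+_; _*_)
open import Data.Fin using (Fin; zero; suc)
open import Data.List using (List; []; _∷_; length)
open import Data.Product using (Σ; _×_; _,_)
open import Relation.Binary.PropositionalEquality using (_≡_)

∑ : (n : ℕ) → (Fin n → ℕ) → ℕ
∑ zero    f = 0
∑ (suc n) f = f zero + ∑ n (λ i → f (suc i))

record NFA (s : ℕ) : Set where
  field
    k   : ℕ
    wt  : Fin k → Fin s → Fin k → ℕ
    in' : Fin k → ℕ
    out : Fin k → ℕ

pathSum : ∀ {s} (M : NFA s) → Fin (NFA.k M) → List (Fin s) → ℕ
pathSum M q []       = NFA.out M q
pathSum M q (a ∷ w)  = ∑ (NFA.k M) (λ q' → NFA.wt M q a q' * pathSum M q' w)

-- Output of M on w: Σ_{q_0,…,q_n} in(q_0) Π_i wt(q_{i-1},w_i,q_i) out(q_n)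
-- (the sum over state sequences, written by nesting the sums).
run : ∀ {s} → NFA s → List (Fin s) → ℕ
run M w = ∑ (NFA.k M) (λ q₀ → NFA.in' M q₀ * pathSum M q₀ w)

InSharpFA : ∀ {s} → (List (Fin s) → ℕ) → Set
InSharpFA {s} f = Σ (NFA s) (λ M → ∀ w → run M w ≡ f w)

{-# OPTIONS --safe #-}
-- Let v(w) q be the weighted number of paths from state q reading w, so
-- that v(a w) q = Σ_q′ wt(q, a, q′) · v(w) q′ and f(w) = Σ_q in(q) · v(w) q.
-- By Vandermonde's identity the binomial coefficient of an ℕ-linear
-- combination of variables is an ℕ-linear combination of products of
-- binomial coefficients of single variables, of the same total degree.
-- Hence the products Π binom(v(w) q, j) of total degree c, of which there
-- are finitely many, satisfy a linear recurrence with ℕ coefficients when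
-- a letter is prepended to w. They serve as the states of an NFA, and
-- binom(f(w), c) is an ℕ-combination of them.
module Submission where

open import Defs
open import Data.Nat using (ℕ)
open import Data.Fin using (Fin)
open import Data.List using (List)
open import Data.Nat.Combinatorics using (_C_)

open import Data.Nat using (zero; suc; _+_; _*_; _^_)
open import Data.Nat.Properties
  using (+-identityʳ; +-assoc; +-suc; *-identityˡ; *-identityʳ; *-zeroʳ; *-assoc; *-comm;
         *-distribˡ-+; *-distribʳ-+; suc-injective; +-commutativeSemigroup)
open import Data.Nat.Combinatorics using (nCk+nC[k+1]≡[n+1]C[k+1])
open import Data.Nat.ListAction using (sum)
open import Data.Nat.ListAction.Properties using (sum-++)
open import Data.Fin using (zero; suc; combine; remQuot)
open import Data.Fin.Properties using (remQuot-combine)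
open import Data.List using ([]; _∷_; [_]; _++_; map; concatMap; replicate; length)
open import Data.List.Properties
  using (map-∘; map-cong; map-cong-local; map-++; length-++; length-replicate)
open import Data.List.Relation.Unary.All as All using (All; []; _∷_)
open import Data.List.Relation.Unary.All.Properties using (map⁺; concat⁺)
open import Data.Product using (_×_; _,_; proj₁; proj₂; map₁)
open import Relation.Binary.PropositionalEquality
  using (_≡_; refl; sym; trans; cong; cong₂; subst; module ≡-Reasoning)
open import Algebra.Properties.CommutativeSemigroup +-commutativeSemigroup
  using (interchange; x∙yz≈y∙xz)

open ≡-Reasoning

∑-cong : ∀ n {f g : Fin n → ℕ} → (∀ i → f i ≡ g i) → ∑ n f ≡ ∑ n g
∑-cong zero    f≗g = refl
∑-cong (suc n) f≗g = cong₂ _+_ (f≗g zero) (∑-cong n (λ i → f≗g (suc i)))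

∑-zero : ∀ n → ∑ n (λ _ → 0) ≡ 0
∑-zero zero    = refl
∑-zero (suc n) = ∑-zero n

∑-distrib-+ : ∀ n (f g : Fin n → ℕ) → ∑ n (λ i → f i + g i) ≡ ∑ n f + ∑ n g
∑-distrib-+ zero    f g = refl
∑-distrib-+ (suc n) f g =
  trans (cong (f zero + g zero +_) (∑-distrib-+ n (λ i → f (suc i)) (λ i → g (suc i))))
        (interchange (f zero) (g zero) _ _)

δ : ∀ {n} → Fin n → Fin n → ℕ
δ zero    zero    = 1
δ zero    (suc _) = 0
δ (suc _) zero    = 0
δ (suc i) (suc j) = δ i j

∑-δ : ∀ n (i : Fin n) (h : Fin n → ℕ) → ∑ n (λ j → δ j i * h j) ≡ h i
∑-δ (suc n) zero    h = trans (cong (h zero + 0 +_) (∑-zero n)) (trans (+-identityʳ _) (+-identityʳ _))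
∑-δ (suc n) (suc i) h = ∑-δ n i (λ j → h (suc j))

multiplicity : ∀ {n} → Fin n → List (Fin n) → ℕ
multiplicity i []      = 0
multiplicity i (j ∷ l) = δ i j + multiplicity i l

∑-multiplicity : ∀ n (l : List (Fin n)) (h : Fin n → ℕ) →
                 ∑ n (λ i → multiplicity i l * h i) ≡ sum (map h l)
∑-multiplicity n []      h = ∑-zero n
∑-multiplicity n (j ∷ l) h = begin
  ∑ n (λ i → (δ i j + multiplicity i l) * h i)
    ≡⟨ ∑-cong n (λ i → *-distribʳ-+ (h i) (δ i j) (multiplicity i l)) ⟩
  ∑ n (λ i → δ i j * h i + multiplicity i l * h i)
    ≡⟨ ∑-distrib-+ n _ _ ⟩
  ∑ n (λ i → δ i j * h i) + ∑ n (λ i → multiplicity i l * h i)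
    ≡⟨ cong₂ _+_ (∑-δ n j h) (∑-multiplicity n l h) ⟩
  h j + sum (map h l) ∎

sum-map-+ : ∀ {A : Set} (f g : A → ℕ) (l : List A) →
            sum (map (λ a → f a + g a) l) ≡ sum (map f l) + sum (map g l)
sum-map-+ f g []      = refl
sum-map-+ f g (a ∷ l) = trans (cong (f a + g a +_) (sum-map-+ f g l)) (interchange (f a) (g a) _ _)

sum-map-*ˡ : ∀ {A : Set} (c : ℕ) (f : A → ℕ) (l : List A) →
             sum (map (λ a → c * f a) l) ≡ c * sum (map f l)
sum-map-*ˡ c f []      = sym (*-zeroʳ c)
sum-map-*ˡ c f (a ∷ l) = trans (cong (c * f a +_) (sum-map-*ˡ c f l)) (sym (*-distribˡ-+ c (f a) _))

sum-map-*ʳ : ∀ {A : Set} (c : ℕ) (f : A → ℕ) (l : List A) →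
             sum (map (λ a → f a * c) l) ≡ sum (map f l) * c
sum-map-*ʳ c f l = begin
  sum (map (λ a → f a * c) l) ≡⟨ cong sum (map-cong (λ a → *-comm (f a) c) l) ⟩
  sum (map (λ a → c * f a) l) ≡⟨ sum-map-*ˡ c f l ⟩
  c * sum (map f l)           ≡⟨ *-comm c _ ⟩
  sum (map f l) * c           ∎

sum-map-replicate : ∀ {A : Set} (f : A → ℕ) m a → sum (map f (replicate m a)) ≡ m * f a
sum-map-replicate f zero    a = refl
sum-map-replicate f (suc m) a = cong (f a +_) (sum-map-replicate f m a)

copies : ∀ n → (Fin n → ℕ) → List (Fin n)
copies zero    A = []
copies (suc n) A = replicate (A zero) zero ++ map suc (copies n (λ i → A (suc i)))

sum-map-copies : ∀ n (A x : Fin n → ℕ) → sum (map x (copies n A)) ≡ ∑ n (λ i → A i * x i)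
sum-map-copies zero    A x = refl
sum-map-copies (suc n) A x = begin
  sum (map x (replicate (A zero) zero ++ map suc rest))
    ≡⟨ cong sum (map-++ x (replicate (A zero) zero) (map suc rest)) ⟩
  sum (map x (replicate (A zero) zero) ++ map x (map suc rest))
    ≡⟨ sum-++ (map x (replicate (A zero) zero)) _ ⟩
  sum (map x (replicate (A zero) zero)) + sum (map x (map suc rest))
    ≡⟨ cong₂ _+_ (sum-map-replicate x (A zero) zero) (cong sum (sym (map-∘ rest))) ⟩
  A zero * x zero + sum (map (λ i → x (suc i)) rest)
    ≡⟨ cong (A zero * x zero +_) (sum-map-copies n (λ i → A (suc i)) (λ i → x (suc i))) ⟩
  A zero * x zero + ∑ n (λ i → A (suc i) * x (suc i)) ∎
  where rest = copies n (λ i → A (suc i))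

InSharpFA-cong : ∀ {s} {f g : List (Fin s) → ℕ} → (∀ w → f w ≡ g w) → InSharpFA f → InSharpFA g
InSharpFA-cong f≗g (M , run≗f) = M , λ w → trans (run≗f w) (f≗g w)

module FromLinearRecurrence
  {s : ℕ} {S : Set} (Good : S → Set)
  (sem : S → List (Fin s) → ℕ) (next : S → Fin s → List S)
  (sem-∷ : ∀ x a w → sem x (a ∷ w) ≡ sum (map (λ y → sem y w) (next x a)))
  (next-good : ∀ x a → Good x → All Good (next x a))
  {N : ℕ} (encode : S → Fin N) (decode : Fin N → S)
  (decode-encode : ∀ x → Good x → decode (encode x) ≡ x)
  (I : List S) (I-good : All Good I)
  where

  nfa : NFA s
  nfa = record
    { k   = N
    ; wt  = λ e a e′ → multiplicity e′ (map encode (next (decode e) a))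
    ; in' = λ e → multiplicity e (map encode I)
    ; out = λ e → sem (decode e) []
    }

  mutual
    pathSum-encode : ∀ w x → Good x → pathSum nfa (encode x) w ≡ sem x w
    pathSum-encode []      x gx = cong (λ y → sem y []) (decode-encode x gx)
    pathSum-encode (a ∷ w) x gx = begin
      ∑ N (λ e → multiplicity e (map encode (next (decode (encode x)) a)) * pathSum nfa e w)
        ≡⟨ cong (λ y → ∑ N (λ e → multiplicity e (map encode (next y a)) * pathSum nfa e w))
                (decode-encode x gx) ⟩
      ∑ N (λ e → multiplicity e (map encode (next x a)) * pathSum nfa e w)
        ≡⟨ weighted-pathSum w (next x a) (next-good x a gx) ⟩
      sum (map (λ y → sem y w) (next x a))
        ≡⟨ sym (sem-∷ x a w) ⟩
      sem x (a ∷ w) ∎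

    weighted-pathSum : ∀ w l → All Good l →
      ∑ N (λ e → multiplicity e (map encode l) * pathSum nfa e w) ≡ sum (map (λ y → sem y w) l)
    weighted-pathSum w l good = begin
      ∑ N (λ e → multiplicity e (map encode l) * pathSum nfa e w)
        ≡⟨ ∑-multiplicity N (map encode l) (λ e → pathSum nfa e w) ⟩
      sum (map (λ e → pathSum nfa e w) (map encode l))
        ≡⟨ cong sum (sym (map-∘ l)) ⟩
      sum (map (λ y → pathSum nfa (encode y) w) l)
        ≡⟨ cong sum (map-cong-local (All.map (λ {y} gy → pathSum-encode w y gy) good)) ⟩
      sum (map (λ y → sem y w) l) ∎

  inSharpFA : InSharpFA (λ w → sum (map (λ x → sem x w) I))
  inSharpFA = nfa , λ w → weighted-pathSum w I I-good

module _ {m : ℕ} where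

  encodeList : ∀ n → List (Fin (suc m)) → Fin (suc m ^ n)
  encodeList zero    _        = zero
  encodeList (suc n) []       = combine {suc m} {suc m ^ n} zero (encodeList n [])
  encodeList (suc n) (x ∷ xs) = combine {suc m} {suc m ^ n} x (encodeList n xs)

  decodeList : ∀ n → Fin (suc m ^ n) → List (Fin (suc m))
  decodeList zero    _ = []
  decodeList (suc n) e with remQuot {suc m} (suc m ^ n) e
  ... | x , e′ = x ∷ decodeList n e′

  decodeList-encodeList : ∀ n xs → length xs ≡ n → decodeList n (encodeList n xs) ≡ xs
  decodeList-encodeList zero    []       refl = refl
  decodeList-encodeList (suc n) (x ∷ xs) eq =
    cong₂ _∷_ (cong proj₁ remQuot-x)
              (trans (cong (λ p → decodeList n (proj₂ p)) remQuot-x)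
                     (decodeList-encodeList n xs (suc-injective eq)))
    where remQuot-x = remQuot-combine {suc m} {suc m ^ n} x (encodeList n xs)

splits : ℕ → List (ℕ × ℕ)
splits zero    = [ (0 , 0) ]
splits (suc d) = (0 , suc d) ∷ map (map₁ suc) (splits d)

splits-sum : ∀ d → All (λ (i , j) → i + j ≡ d) (splits d)
splits-sum zero    = refl ∷ []
splits-sum (suc d) = refl ∷ map⁺ (All.map (cong suc) (splits-sum d))

sum-map-splits-suc : ∀ (g : ℕ → ℕ → ℕ) d →
  sum (map (λ (i , j) → g i j) (splits (suc d)))
    ≡ g 0 (suc d) + sum (map (λ (i , j) → g (suc i) j) (splits d))
sum-map-splits-suc g d = cong (g 0 (suc d) +_) (cong sum (sym (map-∘ (splits d))))

vandermonde : ∀ m n d → (m + n) C d ≡ sum (map (λ (i , j) → (m C i) * (n C j)) (splits d))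
vandermonde zero    n zero    = refl
vandermonde zero    n (suc d) = sym (begin
  sum (map (λ (i , j) → (0 C i) * (n C j)) (splits (suc d)))
    ≡⟨ sum-map-splits-suc (λ i j → (0 C i) * (n C j)) d ⟩
  1 * (n C suc d) + sum (map (λ (i , j) → 0 * (n C j)) (splits d))
    ≡⟨ cong (1 * (n C suc d) +_) (sum-map-*ˡ 0 (λ (i , j) → n C j) (splits d)) ⟩
  1 * (n C suc d) + 0
    ≡⟨ trans (+-identityʳ _) (*-identityˡ _) ⟩
  n C suc d ∎)
vandermonde (suc m) n zero    = refl
vandermonde (suc m) n (suc d) = begin
  suc (m + n) C suc d
    ≡⟨ sym (nCk+nC[k+1]≡[n+1]C[k+1] (m + n) d) ⟩
  (m + n) C d + (m + n) C suc d
    ≡⟨ cong₂ _+_ (vandermonde m n d)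
                 (trans (vandermonde m n (suc d)) (sum-map-splits-suc (λ i j → (m C i) * (n C j)) d)) ⟩
  A + (1 * (n C suc d) + B)
    ≡⟨ x∙yz≈y∙xz A (1 * (n C suc d)) B ⟩
  1 * (n C suc d) + (A + B)
    ≡⟨ cong (1 * (n C suc d) +_) (sym (sum-map-+ _ _ (splits d))) ⟩
  1 * (n C suc d) + sum (map (λ (i , j) → (m C i) * (n C j) + (m C suc i) * (n C j)) (splits d))
    ≡⟨ cong (1 * (n C suc d) +_) (cong sum (map-cong pascal (splits d))) ⟩
  1 * (n C suc d) + sum (map (λ (i , j) → (suc m C suc i) * (n C j)) (splits d))
    ≡⟨ sym (sum-map-splits-suc (λ i j → (suc m C i) * (n C j)) d) ⟩
  sum (map (λ (i , j) → (suc m C i) * (n C j)) (splits (suc d))) ∎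
  where
  A = sum (map (λ (i , j) → (m C i) * (n C j)) (splits d))
  B = sum (map (λ (i , j) → (m C suc i) * (n C j)) (splits d))
  pascal : ∀ ((i , j) : ℕ × ℕ) →
           (m C i) * (n C j) + (m C suc i) * (n C j) ≡ (suc m C suc i) * (n C j)
  pascal (i , j) = trans (sym (*-distribʳ-+ (n C j) (m C i) _))
                         (cong (_* (n C j)) (nCk+nC[k+1]≡[n+1]C[k+1] m i))

-- Polynomials in variables Fin k with ℕ coefficients, written in the basis
-- of products of binomial coefficients of single variables.
module BinomialBasis (k : ℕ) where

  -- A factor (q , j) stands for binom(x q, suc j): excluding the trivial
  -- factor binom(x q, 0) = 1 leaves finitely many monomials of each degree.
  Monomial : Set
  Monomial = List (Fin k × ℕ)

  Polynomial : Set
  Polynomial = List Monomial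

  ⟦_⟧m : Monomial → (Fin k → ℕ) → ℕ
  ⟦ []          ⟧m x = 1
  ⟦ (q , j) ∷ m ⟧m x = (x q C suc j) * ⟦ m ⟧m x

  ⟦_⟧p : Polynomial → (Fin k → ℕ) → ℕ
  ⟦ P ⟧p x = sum (map (λ m → ⟦ m ⟧m x) P)

  degree : Monomial → ℕ
  degree []            = 0
  degree ((q , j) ∷ m) = suc j + degree m

  Homogeneous : ℕ → Polynomial → Set
  Homogeneous d = All (λ m → degree m ≡ d)

  ⟦++⟧m : ∀ m m′ x → ⟦ m ++ m′ ⟧m x ≡ ⟦ m ⟧m x * ⟦ m′ ⟧m x
  ⟦++⟧m []            m′ x = sym (+-identityʳ _)
  ⟦++⟧m ((q , j) ∷ m) m′ x =
    trans (cong ((x q C suc j) *_) (⟦++⟧m m m′ x)) (sym (*-assoc (x q C suc j) _ _))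

  degree-++ : ∀ m m′ → degree (m ++ m′) ≡ degree m + degree m′
  degree-++ []            m′ = refl
  degree-++ ((q , j) ∷ m) m′ = trans (cong (suc j +_) (degree-++ m m′)) (sym (+-assoc (suc j) _ _))

  scale : Monomial → Polynomial → Polynomial
  scale m = map (m ++_)

  ⟦scale⟧ : ∀ m Q x → ⟦ scale m Q ⟧p x ≡ ⟦ m ⟧m x * ⟦ Q ⟧p x
  ⟦scale⟧ m Q x = begin
    sum (map (λ m″ → ⟦ m″ ⟧m x) (map (m ++_) Q)) ≡⟨ cong sum (sym (map-∘ Q)) ⟩
    sum (map (λ m′ → ⟦ m ++ m′ ⟧m x) Q)           ≡⟨ cong sum (map-cong (λ m′ → ⟦++⟧m m m′ x) Q) ⟩
    sum (map (λ m′ → ⟦ m ⟧m x * ⟦ m′ ⟧m x) Q)     ≡⟨ sum-map-*ˡ (⟦ m ⟧m x) (λ m′ → ⟦ m′ ⟧m x) Q ⟩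
    ⟦ m ⟧m x * ⟦ Q ⟧p x                           ∎

  homogeneous-scale : ∀ m {e Q} → Homogeneous e Q → Homogeneous (degree m + e) (scale m Q)
  homogeneous-scale m homQ =
    map⁺ (All.map (λ {m′} eq → trans (degree-++ m m′) (cong (degree m +_) eq)) homQ)

  ⟦concatMap⟧ : ∀ {A : Set} (F : A → Polynomial) l x →
                ⟦ concatMap F l ⟧p x ≡ sum (map (λ a → ⟦ F a ⟧p x) l)
  ⟦concatMap⟧ F []      x = refl
  ⟦concatMap⟧ F (a ∷ l) x = begin
    sum (map (λ m → ⟦ m ⟧m x) (F a ++ concatMap F l))
      ≡⟨ cong sum (map-++ (λ m → ⟦ m ⟧m x) (F a) (concatMap F l)) ⟩
    sum (map (λ m → ⟦ m ⟧m x) (F a) ++ map (λ m → ⟦ m ⟧m x) (concatMap F l))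
      ≡⟨ sum-++ (map (λ m → ⟦ m ⟧m x) (F a)) _ ⟩
    ⟦ F a ⟧p x + ⟦ concatMap F l ⟧p x
      ≡⟨ cong (⟦ F a ⟧p x +_) (⟦concatMap⟧ F l x) ⟩
    ⟦ F a ⟧p x + sum (map (λ a′ → ⟦ F a′ ⟧p x) l) ∎

  homogeneous-concatMap : ∀ {A : Set} {d} (F : A → Polynomial) {l} →
                          All (λ a → Homogeneous d (F a)) l → Homogeneous d (concatMap F l)
  homogeneous-concatMap F hom = concat⁺ (map⁺ hom)

  _⊗_ : Polynomial → Polynomial → Polynomial
  P ⊗ Q = concatMap (λ m → scale m Q) P

  ⟦⊗⟧ : ∀ P Q x → ⟦ P ⊗ Q ⟧p x ≡ ⟦ P ⟧p x * ⟦ Q ⟧p x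
  ⟦⊗⟧ P Q x = begin
    ⟦ P ⊗ Q ⟧p x                              ≡⟨ ⟦concatMap⟧ (λ m → scale m Q) P x ⟩
    sum (map (λ m → ⟦ scale m Q ⟧p x) P)      ≡⟨ cong sum (map-cong (λ m → ⟦scale⟧ m Q x) P) ⟩
    sum (map (λ m → ⟦ m ⟧m x * ⟦ Q ⟧p x) P)   ≡⟨ sum-map-*ʳ (⟦ Q ⟧p x) (λ m → ⟦ m ⟧m x) P ⟩
    ⟦ P ⟧p x * ⟦ Q ⟧p x                       ∎

  homogeneous-⊗ : ∀ {d e} P Q → Homogeneous d P → Homogeneous e Q → Homogeneous (d + e) (P ⊗ Q)
  homogeneous-⊗ {d} {e} P Q homP homQ = homogeneous-concatMap (λ m → scale m Q) (All.map term homP)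
    where
    term : ∀ {m} → degree m ≡ d → Homogeneous (d + e) (scale m Q)
    term {m} eq = subst (λ d′ → Homogeneous (d′ + e) (scale m Q)) eq (homogeneous-scale m homQ)

  factor : Fin k → ℕ → Monomial
  factor q zero    = []
  factor q (suc i) = [ (q , i) ]

  ⟦factor⟧ : ∀ q i x → ⟦ factor q i ⟧m x ≡ x q C i
  ⟦factor⟧ q zero    x = refl
  ⟦factor⟧ q (suc i) x = *-identityʳ _

  degree-factor : ∀ q i → degree (factor q i) ≡ i
  degree-factor q zero    = refl
  degree-factor q (suc i) = cong suc (+-identityʳ i)

  binomialOf : List (Fin k) → ℕ → Polynomial
  binomialOf []      zero    = [ [] ]
  binomialOf []      (suc d) = []
  binomialOf (q ∷ ℓ) d       = concatMap (λ (i , j) → scale (factor q i) (binomialOf ℓ j)) (splits d)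

  ⟦binomialOf⟧ : ∀ ℓ d x → ⟦ binomialOf ℓ d ⟧p x ≡ sum (map x ℓ) C d
  ⟦binomialOf⟧ []      zero    x = refl
  ⟦binomialOf⟧ []      (suc d) x = refl
  ⟦binomialOf⟧ (q ∷ ℓ) d       x = begin
    ⟦ concatMap (λ (i , j) → scale (factor q i) (binomialOf ℓ j)) (splits d) ⟧p x
      ≡⟨ ⟦concatMap⟧ (λ (i , j) → scale (factor q i) (binomialOf ℓ j)) (splits d) x ⟩
    sum (map (λ (i , j) → ⟦ scale (factor q i) (binomialOf ℓ j) ⟧p x) (splits d))
      ≡⟨ cong sum (map-cong term (splits d)) ⟩
    sum (map (λ (i , j) → (x q C i) * (sum (map x ℓ) C j)) (splits d))
      ≡⟨ sym (vandermonde (x q) (sum (map x ℓ)) d) ⟩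
    (x q + sum (map x ℓ)) C d ∎
    where
    term : ∀ ((i , j) : ℕ × ℕ) →
           ⟦ scale (factor q i) (binomialOf ℓ j) ⟧p x ≡ (x q C i) * (sum (map x ℓ) C j)
    term (i , j) = trans (⟦scale⟧ (factor q i) (binomialOf ℓ j) x)
                         (cong₂ _*_ (⟦factor⟧ q i x) (⟦binomialOf⟧ ℓ j x))

  homogeneous-binomialOf : ∀ ℓ d → Homogeneous d (binomialOf ℓ d)
  homogeneous-binomialOf []      zero    = refl ∷ []
  homogeneous-binomialOf []      (suc d) = []
  homogeneous-binomialOf (q ∷ ℓ) d       =
    homogeneous-concatMap (λ (i , j) → scale (factor q i) (binomialOf ℓ j))
                          (All.map term (splits-sum d))
    where
    term : ∀ {(i , j) : ℕ × ℕ} → i + j ≡ d → Homogeneous d (scale (factor q i) (binomialOf ℓ j))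
    term {i , j} i+j≡d =
      subst (λ e → Homogeneous e (scale (factor q i) (binomialOf ℓ j)))
            (trans (cong (_+ j) (degree-factor q i)) i+j≡d)
            (homogeneous-scale (factor q i) (homogeneous-binomialOf ℓ j))

  -- Monomials of degree d are coded by words of length d, hence by
  -- elements of Fin (suc k ^ d).
  toSlots : Monomial → List (Fin (suc k))
  toSlots []            = []
  toSlots ((q , j) ∷ m) = replicate j zero ++ suc q ∷ toSlots m

  grow : Monomial → Monomial
  grow []            = []
  grow ((q , j) ∷ m) = (q , suc j) ∷ m

  fromSlots : List (Fin (suc k)) → Monomial
  fromSlots []           = []
  fromSlots (zero  ∷ xs) = grow (fromSlots xs)
  fromSlots (suc q ∷ xs) = (q , 0) ∷ fromSlots xs

  fromSlots-block : ∀ j q xs → fromSlots (replicate j zero ++ suc q ∷ xs) ≡ (q , j) ∷ fromSlots xs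
  fromSlots-block zero    q xs = refl
  fromSlots-block (suc j) q xs = cong grow (fromSlots-block j q xs)

  fromSlots-toSlots : ∀ m → fromSlots (toSlots m) ≡ m
  fromSlots-toSlots []            = refl
  fromSlots-toSlots ((q , j) ∷ m) =
    trans (fromSlots-block j q (toSlots m)) (cong ((q , j) ∷_) (fromSlots-toSlots m))

  length-toSlots : ∀ m → length (toSlots m) ≡ degree m
  length-toSlots []            = refl
  length-toSlots ((q , j) ∷ m) = begin
    length (replicate j zero ++ suc q ∷ toSlots m)  ≡⟨ length-++ (replicate j zero) ⟩
    length (replicate j zero) + suc (length (toSlots m))
      ≡⟨ cong₂ (λ a b → a + suc b) (length-replicate j) (length-toSlots m) ⟩
    j + suc (degree m)                              ≡⟨ +-suc j (degree m) ⟩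
    suc j + degree m                                ∎

module BinomialOfNFA {s : ℕ} (M : NFA s) where
  open NFA M
  open BinomialBasis k

  pathSums : List (Fin s) → Fin k → ℕ
  pathSums w q = pathSum M q w

  successors : Fin k → Fin s → List (Fin k)
  successors q a = copies k (wt q a)

  pathSum-∷ : ∀ q a w → pathSum M q (a ∷ w) ≡ sum (map (pathSums w) (successors q a))
  pathSum-∷ q a w = sym (sum-map-copies k (wt q a) (pathSums w))

  run≡sum-copies : ∀ w → run M w ≡ sum (map (pathSums w) (copies k in'))
  run≡sum-copies w = sym (sum-map-copies k in' (pathSums w))

  next : Monomial → Fin s → Polynomial
  next []            a = [ [] ]
  next ((q , j) ∷ m) a = binomialOf (successors q a) (suc j) ⊗ next m a

  ⟦next⟧ : ∀ m a w → ⟦ m ⟧m (pathSums (a ∷ w)) ≡ ⟦ next m a ⟧p (pathSums w)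
  ⟦next⟧ []            a w = refl
  ⟦next⟧ ((q , j) ∷ m) a w = begin
    (pathSum M q (a ∷ w) C suc j) * ⟦ m ⟧m (pathSums (a ∷ w))
      ≡⟨ cong₂ (λ y z → (y C suc j) * z) (pathSum-∷ q a w) (⟦next⟧ m a w) ⟩
    (sum (map (pathSums w) (successors q a)) C suc j) * ⟦ next m a ⟧p (pathSums w)
      ≡⟨ cong (_* ⟦ next m a ⟧p (pathSums w))
              (sym (⟦binomialOf⟧ (successors q a) (suc j) (pathSums w))) ⟩
    ⟦ binomialOf (successors q a) (suc j) ⟧p (pathSums w) * ⟦ next m a ⟧p (pathSums w)
      ≡⟨ sym (⟦⊗⟧ (binomialOf (successors q a) (suc j)) (next m a) (pathSums w)) ⟩
    ⟦ next ((q , j) ∷ m) a ⟧p (pathSums w) ∎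

  homogeneous-next : ∀ m a → Homogeneous (degree m) (next m a)
  homogeneous-next []            a = refl ∷ []
  homogeneous-next ((q , j) ∷ m) a =
    homogeneous-⊗ (binomialOf (successors q a) (suc j)) (next m a)
      (homogeneous-binomialOf (successors q a) (suc j)) (homogeneous-next m a)

  binomial-inSharpFA : ∀ c → InSharpFA (λ w → ⟦ binomialOf (copies k in') c ⟧p (pathSums w))
  binomial-inSharpFA c =
    FromLinearRecurrence.inSharpFA
      (λ m → degree m ≡ c) (λ m w → ⟦ m ⟧m (pathSums w)) next ⟦next⟧
      (λ m a deg≡c → subst (λ d → Homogeneous d (next m a)) deg≡c (homogeneous-next m a))
      (λ m → encodeList c (toSlots m)) (λ e → fromSlots (decodeList c e)) decode-encode
      (binomialOf (copies k in') c) (homogeneous-binomialOf (copies k in') c)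
    where
    decode-encode : ∀ m → degree m ≡ c → fromSlots (decodeList c (encodeList c (toSlots m))) ≡ m
    decode-encode m deg≡c = trans (cong fromSlots (decodeList-encodeList c (toSlots m)
                                                     (trans (length-toSlots m) deg≡c)))
                                  (fromSlots-toSlots m)

lemma11 : (s : ℕ) (f : List (Fin s) → ℕ) → InSharpFA f →
    (c : ℕ) → InSharpFA (λ w → f w C c)
lemma11 s f (M , run≡f) c = InSharpFA-cong binomial≡ (binomial-inSharpFA c)
  where
  open NFA M
  open BinomialBasis k
  open BinomialOfNFA M
  binomial≡ : ∀ w → ⟦ binomialOf (copies k in') c ⟧p (pathSums w) ≡ f w C c
  binomial≡ w = begin
    ⟦ binomialOf (copies k in') c ⟧p (pathSums w) ≡⟨ ⟦binomialOf⟧ (copies k in') c (pathSums w) ⟩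
    sum (map (pathSums w) (copies k in')) C c     ≡⟨ cong (_C c) (sym (run≡sum-copies w)) ⟩
    run M w C c                                   ≡⟨ cong (_C c) (run≡f w) ⟩
    f w C c                                       ∎
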